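{- Let $G$ be a finite simple, connected, 2-edge-connected graph with $Mo(G)=3$. Then the set $\{\mathrm{Tr}_G(v): v\in V(G)\}$ of vertex transmissions consists of exactly two consecutive positive integers.
   Context: For a connected graph $G$ and $v\in V(G)$, the transmission is $\mathrm{Tr}_G(v)=\sum_{u\in V(G)}d_G(u,v)$, where $d_G$ is the shortest-path distance. For an edge $uv\in E(G)$, let $n_u$ be the number of vertices strictly closer to $u$ than to $v$, and $n_v$ analogously. The Mostar index is $Mo(G)=\sum_{uv\in E(G)}|n_u-n_v|$. A graph is 2-edge-connected if it is connected and has no bridge. -}

module Defs where

open import Data.Nat using (ℕ; zero; suc; _+_; _≤_; _<ᵇ_; ∣_-_∣)
open import Data.Fin using (Fin; toℕ; _≟_)
open import Data.Bool using (Bool; true; false; if_then_else_; _∧_; not; _∨_)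
open import Data.List using (List; map; allFin)
open import Data.Nat.ListAction using (sum)
open import Data.Product using (Σ; _×_; _,_)
open import Relation.Binary.PropositionalEquality using (_≡_)
open import Relation.Nullary.Decidable using (⌊_⌋)

Adjacency : ℕ → Set
Adjacency n = Fin n → Fin n → Bool

record SimpleGraph (n : ℕ) : Set where
  field
    adj    : Adjacency n
    sym    : ∀ u v → adj u v ≡ adj v u
    irrefl : ∀ v → adj v v ≡ false
open SimpleGraph public

data Walk {n : ℕ} (A : Adjacency n) : Fin n → Fin n → ℕ → Set where
  here : ∀ {u} → Walk A u u zero
  step : ∀ {u w v k} → A u w ≡ true → Walk A w v k → Walk A u v (suc k)

Connected : ∀ {n} → Adjacency n → Set
Connected {n} A = ∀ (u v : Fin n) → Σ ℕ (λ k → Walk A u v k)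

deleteEdge : ∀ {n} → Adjacency n → Fin n → Fin n → Adjacency n
deleteEdge A a b x y =
  A x y ∧ not ((⌊ x ≟ a ⌋ ∧ ⌊ y ≟ b ⌋) ∨ (⌊ x ≟ b ⌋ ∧ ⌊ y ≟ a ⌋))

TwoEdgeConnected : ∀ {n} → SimpleGraph n → Set
TwoEdgeConnected {n} G =
  Connected (adj G) ×
  (∀ (a b : Fin n) → adj G a b ≡ true → Connected (deleteEdge (adj G) a b))

IsDistance : ∀ {n} → SimpleGraph n → (Fin n → Fin n → ℕ) → Set
IsDistance {n} G d =
  ∀ (u v : Fin n) → Walk (adj G) u v (d u v) × (∀ k → Walk (adj G) u v k → d u v ≤ k)

Σ-Fin : ∀ n → (Fin n → ℕ) → ℕ
Σ-Fin n f = sum (map f (allFin n))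

Tr : ∀ {n} → (Fin n → Fin n → ℕ) → Fin n → ℕ
Tr {n} d v = Σ-Fin n (λ u → d u v)

closerTo : ∀ {n} → (Fin n → Fin n → ℕ) → Fin n → Fin n → ℕ
closerTo {n} d u v = Σ-Fin n (λ w → if d w u <ᵇ d w v then 1 else 0)

Mostar : ∀ {n} → SimpleGraph n → (Fin n → Fin n → ℕ) → ℕ
Mostar {n} G d =
  Σ-Fin n (λ u → Σ-Fin n (λ v →
    if (toℕ u <ᵇ toℕ v) ∧ adj G u v
    then ∣ closerTo d u v - closerTo d v u ∣
    else 0))

{-# OPTIONS --safe #-}
module Submission where

-- For an edge uv every vertex w has |d(w,u) − d(w,v)| ≤ 1, which gives
-- Tr(u) + n_u = Tr(v) + n_v and hence Mo(G) = Σ_{uv ∈ E} |Tr(u) − Tr(v)|.  Let t be the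
-- least transmission.  If some vertex had transmission ≥ t + 2, both {Tr ≤ t} and
-- {Tr ≤ t + 1} would be proper nonempty vertex sets, each left by at least two edges of the
-- 2-edge-connected graph G; an edge leaving both contributes at least 2 to the sum, so
-- Mo(G) ≥ 4.  Hence all transmissions lie in {t, t + 1}, and Mo(G) ≠ 0 yields an edge
-- whose ends realise both values.

open import Defs hiding (sym)
open import Data.Bool using (Bool; true; false; if_then_else_; _∧_; _xor_)
open import Data.Bool.Properties using (xor-comm)
open import Data.Fin using (Fin; zero; suc; toℕ; _≟_)
open import Data.Fin.Properties using (toℕ-injective)
open import Data.List using (allFin)
open import Data.List.Membership.Propositional.Properties using (∈-allFin)
open import Data.List.Properties using (map-tabulate; map-cong)
open import Data.List.Relation.Unary.All using () renaming (lookup to All-lookup)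
open import Data.Nat using (ℕ; zero; suc; _+_; _≤_; _<_; _<ᵇ_; _≤ᵇ_; ∣_-_∣; z≤n; s≤s; z<s)
open import Data.Nat.ListAction using (sum)
open import Data.Nat.Properties hiding (_≟_)
open import Algebra.Properties.CommutativeSemigroup +-commutativeSemigroup using (interchange)
open import Data.List.Extrema ≤-totalOrder using (argmin; f[argmin]≤f[xs])
open import Data.Product using (Σ; ∃; ∃₂; _×_; _,_; proj₁; proj₂; swap)
open import Data.Product.Properties using (,-injective)
open import Data.Sum using (_⊎_; inj₁; inj₂; [_,_]′)
open import Function using (_∘_; id)
open import Relation.Nullary using (yes; no; contradiction)
open import Relation.Nullary.Reflects using (ofʸ; ofⁿ)
open import Relation.Binary.Definitions using (tri<; tri≈; tri>)
open import Relation.Binary.PropositionalEquality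
  using (_≡_; _≢_; refl; sym; trans; cong; cong₂; subst; module ≡-Reasoning)

private
  variable
    n : ℕ

Σ-Fin-suc : ∀ n (f : Fin (suc n) → ℕ) → Σ-Fin (suc n) f ≡ f zero + Σ-Fin n (f ∘ suc)
Σ-Fin-suc n f =
  cong (λ xs → f zero + sum xs) (trans (map-tabulate (id ∘ suc) f) (sym (map-tabulate id (f ∘ suc))))

Σ-Fin-cong : ∀ n {f g : Fin n → ℕ} → (∀ i → f i ≡ g i) → Σ-Fin n f ≡ Σ-Fin n g
Σ-Fin-cong n f≗g = cong sum (map-cong f≗g (allFin n))

Σ-Fin-mono : ∀ n {f g : Fin n → ℕ} → (∀ i → f i ≤ g i) → Σ-Fin n f ≤ Σ-Fin n g
Σ-Fin-mono zero    f≤g = z≤n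
Σ-Fin-mono (suc n) {f} {g} f≤g rewrite Σ-Fin-suc n f | Σ-Fin-suc n g =
  +-mono-≤ (f≤g zero) (Σ-Fin-mono n (f≤g ∘ suc))

Σ-Fin-distrib-+ : ∀ n (f g : Fin n → ℕ) →
  Σ-Fin n (λ i → f i + g i) ≡ Σ-Fin n f + Σ-Fin n g
Σ-Fin-distrib-+ zero    f g = refl
Σ-Fin-distrib-+ (suc n) f g = begin
  Σ-Fin (suc n) (λ i → f i + g i)
    ≡⟨ Σ-Fin-suc n _ ⟩
  (f zero + g zero) + Σ-Fin n (λ i → f (suc i) + g (suc i))
    ≡⟨ cong (f zero + g zero +_) (Σ-Fin-distrib-+ n (f ∘ suc) (g ∘ suc)) ⟩
  (f zero + g zero) + (Σ-Fin n (f ∘ suc) + Σ-Fin n (g ∘ suc))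
    ≡⟨ interchange (f zero) (g zero) _ _ ⟩
  (f zero + Σ-Fin n (f ∘ suc)) + (g zero + Σ-Fin n (g ∘ suc))
    ≡⟨ sym (cong₂ _+_ (Σ-Fin-suc n f) (Σ-Fin-suc n g)) ⟩
  Σ-Fin (suc n) f + Σ-Fin (suc n) g ∎
  where open ≡-Reasoning

term≤Σ-Fin : ∀ n (f : Fin n → ℕ) i → f i ≤ Σ-Fin n f
term≤Σ-Fin (suc n) f i rewrite Σ-Fin-suc n f with i
... | zero  = m≤m+n (f zero) _
... | suc j = ≤-trans (term≤Σ-Fin n (f ∘ suc) j) (m≤n+m _ (f zero))

two-terms≤Σ-Fin : ∀ n (f : Fin n → ℕ) {i j} → i ≢ j → f i + f j ≤ Σ-Fin n f
two-terms≤Σ-Fin (suc n) f {i} {j} i≢j rewrite Σ-Fin-suc n f with i | j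
... | zero  | zero  = contradiction refl i≢j
... | zero  | suc j = +-monoʳ-≤ (f zero) (term≤Σ-Fin n (f ∘ suc) j)
... | suc i | zero  =
  subst (_≤ f zero + Σ-Fin n (f ∘ suc)) (+-comm (f zero) (f (suc i)))
    (+-monoʳ-≤ (f zero) (term≤Σ-Fin n (f ∘ suc) i))
... | suc i | suc j =
  ≤-trans (two-terms≤Σ-Fin n (f ∘ suc) (i≢j ∘ cong suc)) (m≤n+m _ (f zero))

Σ-Fin-pos⇒term-pos : ∀ n (f : Fin n → ℕ) → 0 < Σ-Fin n f → ∃ λ i → 0 < f i
Σ-Fin-pos⇒term-pos (suc n) f 0<Σ rewrite Σ-Fin-suc n f with f zero in f₀
... | suc _ = zero , subst (0 <_) (sym f₀) z<s
... | zero with Σ-Fin-pos⇒term-pos n (f ∘ suc) 0<Σ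
...   | i , 0<fi = suc i , 0<fi

two-terms≤Σ-Fin² : ∀ m n (f : Fin m → Fin n → ℕ) {i j i′ j′} → (i , j) ≢ (i′ , j′) →
  f i j + f i′ j′ ≤ Σ-Fin m (λ i → Σ-Fin n (f i))
two-terms≤Σ-Fin² m n f {i} {j} {i′} {j′} ij≢i′j′ with i ≟ i′
... | no i≢i′ =
  ≤-trans (+-mono-≤ (term≤Σ-Fin n (f i) j) (term≤Σ-Fin n (f i′) j′))
          (two-terms≤Σ-Fin m _ i≢i′)
... | yes refl =
  ≤-trans (two-terms≤Σ-Fin n (f i) (ij≢i′j′ ∘ cong (i ,_))) (term≤Σ-Fin m _ i)

-- Each edge {u, v} is counted once, as the pair with toℕ u < toℕ v; with this
-- convention Mostar G d is, by definition, the edge sum of |n_u − n_v|.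
edgeTerm : SimpleGraph n → (Fin n → Fin n → ℕ) → Fin n → Fin n → ℕ
edgeTerm G f u v = if (toℕ u <ᵇ toℕ v) ∧ adj G u v then f u v else 0

EdgeSum : SimpleGraph n → (Fin n → Fin n → ℕ) → ℕ
EdgeSum {n} G f = Σ-Fin n (λ u → Σ-Fin n (edgeTerm G f u))

adj⇒≢ : (G : SimpleGraph n) {u v : Fin n} → adj G u v ≡ true → u ≢ v
adj⇒≢ G {u} uv refl with trans (sym (irrefl G u)) uv
... | ()

module _ (G : SimpleGraph n) where

  edgeTerm-mono : {f g : Fin n → Fin n → ℕ} → (∀ {u v} → adj G u v ≡ true → f u v ≤ g u v) →
    ∀ u v → edgeTerm G f u v ≤ edgeTerm G g u v
  edgeTerm-mono f≤g u v with toℕ u <ᵇ toℕ v | adj G u v in uv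
  ... | false | _     = z≤n
  ... | true  | false = z≤n
  ... | true  | true  = f≤g uv

  edgeTerm-distrib-+ : (f g : Fin n → Fin n → ℕ) →
    ∀ u v → edgeTerm G (λ u v → f u v + g u v) u v ≡ edgeTerm G f u v + edgeTerm G g u v
  edgeTerm-distrib-+ f g u v with (toℕ u <ᵇ toℕ v) ∧ adj G u v
  ... | false = refl
  ... | true  = refl

  edgeTerm-edge : (f : Fin n → Fin n → ℕ) {u v : Fin n} → toℕ u < toℕ v → adj G u v ≡ true →
    edgeTerm G f u v ≡ f u v
  edgeTerm-edge f {u} {v} u<v uv with toℕ u <ᵇ toℕ v | <ᵇ-reflects-< (toℕ u) (toℕ v)
  ... | false | ofⁿ u≮v = contradiction u<v u≮v
  ... | true  | _       rewrite uv = refl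

  edgeTerm-pos⇒edge : (f : Fin n → Fin n → ℕ) {u v : Fin n} → 0 < edgeTerm G f u v →
    adj G u v ≡ true × 0 < f u v
  edgeTerm-pos⇒edge f {u} {v} pos with toℕ u <ᵇ toℕ v | adj G u v
  ... | true | true = refl , pos

  EdgeSum-mono : {f g : Fin n → Fin n → ℕ} → (∀ {u v} → adj G u v ≡ true → f u v ≤ g u v) →
    EdgeSum G f ≤ EdgeSum G g
  EdgeSum-mono f≤g = Σ-Fin-mono n (λ u → Σ-Fin-mono n (edgeTerm-mono f≤g u))

  EdgeSum-cong : {f g : Fin n → Fin n → ℕ} → (∀ {u v} → adj G u v ≡ true → f u v ≡ g u v) →
    EdgeSum G f ≡ EdgeSum G g
  EdgeSum-cong f≡g =
    ≤-antisym (EdgeSum-mono (≤-reflexive ∘ f≡g)) (EdgeSum-mono (≤-reflexive ∘ sym ∘ f≡g))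

  EdgeSum-distrib-+ : (f g : Fin n → Fin n → ℕ) →
    EdgeSum G (λ u v → f u v + g u v) ≡ EdgeSum G f + EdgeSum G g
  EdgeSum-distrib-+ f g = begin
    EdgeSum G (λ u v → f u v + g u v)
      ≡⟨ Σ-Fin-cong n (λ u → Σ-Fin-cong n (edgeTerm-distrib-+ f g u)) ⟩
    Σ-Fin n (λ u → Σ-Fin n (λ v → edgeTerm G f u v + edgeTerm G g u v))
      ≡⟨ Σ-Fin-cong n (λ u → Σ-Fin-distrib-+ n (edgeTerm G f u) (edgeTerm G g u)) ⟩
    Σ-Fin n (λ u → Σ-Fin n (edgeTerm G f u) + Σ-Fin n (edgeTerm G g u))
      ≡⟨ Σ-Fin-distrib-+ n _ _ ⟩
    EdgeSum G f + EdgeSum G g ∎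
    where open ≡-Reasoning

  EdgeSum-pos⇒edge : (f : Fin n → Fin n → ℕ) → 0 < EdgeSum G f →
    ∃₂ λ u v → adj G u v ≡ true × 0 < f u v
  EdgeSum-pos⇒edge f pos with Σ-Fin-pos⇒term-pos n _ pos
  ... | u , pos′ with Σ-Fin-pos⇒term-pos n _ pos′
  ...   | v , pos″ = u , v , edgeTerm-pos⇒edge f pos″

  module _ {f : Fin n → Fin n → ℕ} (f-sym : ∀ u v → f u v ≡ f v u) where

    edgeTerm-oriented : {x y : Fin n} → adj G x y ≡ true →
      ∃₂ λ p q → ((p , q) ≡ (x , y) ⊎ (p , q) ≡ (y , x)) × edgeTerm G f p q ≡ f x y
    edgeTerm-oriented {x} {y} xy with <-cmp (toℕ x) (toℕ y)
    ... | tri< x<y _ _ = x , y , inj₁ refl , edgeTerm-edge f x<y xy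
    ... | tri≈ _ x≡y _ = contradiction (toℕ-injective x≡y) (adj⇒≢ G xy)
    ... | tri> _ _ y<x =
      y , x , inj₂ refl , trans (edgeTerm-edge f y<x (trans (SimpleGraph.sym G y x) xy)) (f-sym y x)

    two-edges≤EdgeSum : {x y x′ y′ : Fin n} → adj G x y ≡ true → adj G x′ y′ ≡ true →
      (x , y) ≢ (x′ , y′) → (x , y) ≢ (y′ , x′) → f x y + f x′ y′ ≤ EdgeSum G f
    two-edges≤EdgeSum {x} {y} {x′} {y′} xy x′y′ ≢same ≢reversed
      with edgeTerm-oriented xy | edgeTerm-oriented x′y′
    ... | p , q , pq , fpq | p′ , q′ , p′q′ , fp′q′ =
      subst (_≤ EdgeSum G f) (cong₂ _+_ fpq fp′q′)
        (two-terms≤Σ-Fin² n n (edgeTerm G f) (distinct pq p′q′))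
      where
      distinct : (p , q) ≡ (x , y) ⊎ (p , q) ≡ (y , x) →
        (p′ , q′) ≡ (x′ , y′) ⊎ (p′ , q′) ≡ (y′ , x′) → (p , q) ≢ (p′ , q′)
      distinct (inj₁ pq) (inj₁ p′q′) eq = ≢same (trans (sym pq) (trans eq p′q′))
      distinct (inj₁ pq) (inj₂ p′q′) eq = ≢reversed (trans (sym pq) (trans eq p′q′))
      distinct (inj₂ pq) (inj₁ p′q′) eq = ≢reversed (cong swap (trans (sym pq) (trans eq p′q′)))
      distinct (inj₂ pq) (inj₂ p′q′) eq = ≢same (cong swap (trans (sym pq) (trans eq p′q′)))

record CrossingEdge (A : Adjacency n) (S : Fin n → Bool) : Set where
  field
    {inner outer} : Fin n
    adjacent      : A inner outer ≡ true
    inner∈S       : S inner ≡ true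
    outer∉S       : S outer ≡ false
open CrossingEdge

crossing-edge : {A : Adjacency n} (S : Fin n → Bool) {a b : Fin n} {k : ℕ} →
  Walk A a b k → S a ≡ true → S b ≡ false → CrossingEdge A S
crossing-edge S here a∈S b∉S with trans (sym a∈S) b∉S
... | ()
crossing-edge S (step {w = w} aw walk) a∈S b∉S with S w in w∈?S
... | true  = crossing-edge S walk w∈?S b∉S
... | false = record { adjacent = aw ; inner∈S = a∈S ; outer∉S = w∈?S }

deleteEdge⇒adj : (A : Adjacency n) {a b x y : Fin n} → deleteEdge A a b x y ≡ true →
  A x y ≡ true × (x , y) ≢ (a , b)
deleteEdge⇒adj A {a} {b} {x} {y} xy with A x y | x ≟ a | y ≟ b
... | true | no x≢a  | _      = refl , x≢a ∘ proj₁ ∘ ,-injective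
... | true | yes _   | no y≢b = refl , y≢b ∘ proj₂ ∘ ,-injective

-- Deleting the first crossing edge found keeps the graph connected, and a walk there
-- leaves S through a second, different edge.
two-crossing-edges : (G : SimpleGraph n) → TwoEdgeConnected G → (S : Fin n → Bool) {a b : Fin n} →
  S a ≡ true → S b ≡ false →
  Σ (CrossingEdge (adj G) S) λ e → Σ (CrossingEdge (adj G) S) λ e′ →
    (inner e , outer e) ≢ (inner e′ , outer e′)
two-crossing-edges G (connected , bridgeless) S {a} {b} a∈S b∉S =
  e , record { adjacent = proj₁ e′-in-G ; inner∈S = inner∈S e′ ; outer∉S = outer∉S e′ } ,
  proj₂ e′-in-G ∘ sym
  where
  e = crossing-edge S (proj₂ (connected a b)) a∈S b∉S
  e′ = crossing-edge S (proj₂ (bridgeless _ _ (adjacent e) (inner e) (outer e))) (inner∈S e) (outer∉S e)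
  e′-in-G = deleteEdge⇒adj (adj G) (adjacent e′)

indicator : Bool → ℕ
indicator b = if b then 1 else 0

cut : (Fin n → Bool) → Fin n → Fin n → ℕ
cut S u v = indicator (S u xor S v)

2≤EdgeSum-cut : (G : SimpleGraph n) → TwoEdgeConnected G → (S : Fin n → Bool) {a b : Fin n} →
  S a ≡ true → S b ≡ false → 2 ≤ EdgeSum G (cut S)
2≤EdgeSum-cut G tec S a∈S b∉S with two-crossing-edges G tec S a∈S b∉S
... | e , e′ , e≢e′ =
  subst (_≤ EdgeSum G (cut S)) (cong₂ _+_ (cut-crossing e) (cut-crossing e′))
    (two-edges≤EdgeSum G cut-sym (adjacent e) (adjacent e′) e≢e′ e≢reversed-e′)
  where
  cut-sym : ∀ u v → cut S u v ≡ cut S v u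
  cut-sym u v = cong indicator (xor-comm (S u) (S v))
  cut-crossing : (e : CrossingEdge (adj G) S) → cut S (inner e) (outer e) ≡ 1
  cut-crossing e rewrite inner∈S e | outer∉S e = refl
  e≢reversed-e′ : (inner e , outer e) ≢ (outer e′ , inner e′)
  e≢reversed-e′ eq with trans (sym (inner∈S e)) (trans (cong S (proj₁ (,-injective eq))) (outer∉S e′))
  ... | ()

separates : ℕ → ℕ → ℕ → Bool
separates s x y = (x ≤ᵇ s) xor (y ≤ᵇ s)

Between : ℕ → ℕ → ℕ → Set
Between s x y = x ≤ s × s < y

separates⇒between : ∀ s x y → separates s x y ≡ true → Between s x y ⊎ Between s y x
separates⇒between s x y sep with x ≤ᵇ s | ≤ᵇ-reflects-≤ x s | y ≤ᵇ s | ≤ᵇ-reflects-≤ y s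
... | true  | ofʸ x≤s | false | ofⁿ y≰s = inj₁ (x≤s , ≰⇒> y≰s)
... | false | ofⁿ x≰s | true  | ofʸ y≤s = inj₂ (y≤s , ≰⇒> x≰s)

m+n≤o⇒m≤∣n-o∣ : ∀ m {n o} → m + n ≤ o → m ≤ ∣ n - o ∣
m+n≤o⇒m≤∣n-o∣ m {n} m+n≤o =
  subst (m ≤_) (sym (m≤n⇒∣m-n∣≡n∸m (≤-trans (m≤n+m n m) m+n≤o))) (m+n≤o⇒m≤o∸n m m+n≤o)

between⇒1≤∣-∣ : ∀ {s x y} → Between s x y ⊎ Between s y x → 1 ≤ ∣ x - y ∣
between⇒1≤∣-∣ {s} {x} {y} (inj₁ (x≤s , s<y)) = m+n≤o⇒m≤∣n-o∣ 1 (≤-trans (s≤s x≤s) s<y)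
between⇒1≤∣-∣ {s} {x} {y} (inj₂ (y≤s , s<x)) =
  subst (1 ≤_) (∣-∣-comm y x) (m+n≤o⇒m≤∣n-o∣ 1 (≤-trans (s≤s y≤s) s<x))

between₂⇒2≤∣-∣ : ∀ {s x y} → Between s x y ⊎ Between s y x →
  Between (suc s) x y ⊎ Between (suc s) y x → 2 ≤ ∣ x - y ∣
between₂⇒2≤∣-∣ (inj₁ (x≤s , _)) (inj₁ (_ , 1+s<y)) = m+n≤o⇒m≤∣n-o∣ 2 (≤-trans (s≤s (s≤s x≤s)) 1+s<y)
between₂⇒2≤∣-∣ {x = x} {y} (inj₂ (y≤s , _)) (inj₂ (_ , 1+s<x)) =
  subst (2 ≤_) (∣-∣-comm y x) (m+n≤o⇒m≤∣n-o∣ 2 (≤-trans (s≤s (s≤s y≤s)) 1+s<x))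
between₂⇒2≤∣-∣ (inj₁ (x≤s , _)) (inj₂ (_ , 1+s<x)) = contradiction (m≤n⇒m≤1+n x≤s) (<⇒≱ 1+s<x)
between₂⇒2≤∣-∣ (inj₂ (y≤s , _)) (inj₁ (_ , 1+s<y)) = contradiction (m≤n⇒m≤1+n y≤s) (<⇒≱ 1+s<y)

-- Two consecutive thresholds can both separate x from y only if |x − y| ≥ 2.
separations≤∣-∣ : ∀ s x y →
  indicator (separates s x y) + indicator (separates (suc s) x y) ≤ ∣ x - y ∣
separations≤∣-∣ s x y with separates s x y in sep | separates (suc s) x y in sep′
... | false | false = z≤n
... | true  | false = between⇒1≤∣-∣ (separates⇒between s x y sep)
... | false | true  = between⇒1≤∣-∣ (separates⇒between (suc s) x y sep′)
... | true  | true  =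
  between₂⇒2≤∣-∣ (separates⇒between s x y sep) (separates⇒between (suc s) x y sep′)

below : ℕ → (Fin n → ℕ) → Fin n → Bool
below s h v = h v ≤ᵇ s

≤⇒≤ᵇ≡true : ∀ {m n} → m ≤ n → (m ≤ᵇ n) ≡ true
≤⇒≤ᵇ≡true {m} {n} m≤n with m ≤ᵇ n | ≤ᵇ-reflects-≤ m n
... | true  | _       = refl
... | false | ofⁿ m≰n = contradiction m≤n m≰n

>⇒≤ᵇ≡false : ∀ {m n} → n < m → (m ≤ᵇ n) ≡ false
>⇒≤ᵇ≡false {m} {n} n<m with m ≤ᵇ n | ≤ᵇ-reflects-≤ m n
... | false | _       = refl
... | true  | ofʸ m≤n = contradiction m≤n (<⇒≱ n<m)

minimum : (h : Fin n → ℕ) → Fin n → ∃ λ a → ∀ w → h a ≤ h w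
minimum {n} h u =
  argmin h u (allFin n) , λ w → All-lookup (f[argmin]≤f[xs] u (allFin n)) (∈-allFin w)

≤∧≤1+⇒≡∨≡1+ : ∀ {t x : ℕ} → t ≤ x → x ≤ suc t → x ≡ t ⊎ x ≡ suc t
≤∧≤1+⇒≡∨≡1+ t≤x x≤1+t with m≤n⇒m<n∨m≡n x≤1+t
... | inj₁ x<1+t = inj₁ (≤-antisym (m<1+n⇒m≤n x<1+t) t≤x)
... | inj₂ x≡1+t = inj₂ x≡1+t

one-is-suc : ∀ {t x y : ℕ} → x ≢ y → x ≡ t ⊎ x ≡ suc t → y ≡ t ⊎ y ≡ suc t →
  x ≡ suc t ⊎ y ≡ suc t
one-is-suc _   (inj₂ x≡1+t) _            = inj₁ x≡1+t
one-is-suc _   (inj₁ _)     (inj₂ y≡1+t) = inj₂ y≡1+t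
one-is-suc x≢y (inj₁ x≡t)   (inj₁ y≡t)   = contradiction (trans x≡t (sym y≡t)) x≢y

module _ (G : SimpleGraph n) (tec : TwoEdgeConnected G) (h : Fin n → ℕ) where

  4≤EdgeSum∣-∣ : ∀ {a b} → 2 + h a ≤ h b → 4 ≤ EdgeSum G (λ u v → ∣ h u - h v ∣)
  4≤EdgeSum∣-∣ {a} {b} gap = begin
    4
      ≤⟨ +-mono-≤ (level-cut s ≤-refl (≤-trans (n≤1+n _) gap)) (level-cut (suc s) (n≤1+n s) gap) ⟩
    EdgeSum G (cut (below s h)) + EdgeSum G (cut (below (suc s) h))
      ≡⟨ EdgeSum-distrib-+ G (cut (below s h)) (cut (below (suc s) h)) ⟨
    EdgeSum G (λ u v → cut (below s h) u v + cut (below (suc s) h) u v)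
      ≤⟨ EdgeSum-mono G (λ {u} {v} _ → separations≤∣-∣ s (h u) (h v)) ⟩
    EdgeSum G (λ u v → ∣ h u - h v ∣) ∎
    where
    open ≤-Reasoning
    s = h a
    level-cut : ∀ r → h a ≤ r → r < h b → 2 ≤ EdgeSum G (cut (below r h))
    level-cut r a≤r r<b = 2≤EdgeSum-cut G tec (below r h) (≤⇒≤ᵇ≡true a≤r) (>⇒≤ᵇ≡false r<b)

  two-consecutive-values :
    0 < EdgeSum G (λ u v → ∣ h u - h v ∣) → EdgeSum G (λ u v → ∣ h u - h v ∣) < 4 →
    Σ ℕ λ t → (∀ v → h v ≡ t ⊎ h v ≡ suc t) × (∃ λ v → h v ≡ t) × (∃ λ v → h v ≡ suc t)
  two-consecutive-values pos <4 with EdgeSum-pos⇒edge G (λ u v → ∣ h u - h v ∣) pos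
  ... | u , v , _ , 0<∣hu-hv∣ with minimum h u
  ...   | a , minimal =
    h a , values , (a , refl) , [ u ,_ , v ,_ ]′ (one-is-suc hu≢hv (values u) (values v))
    where
    values : ∀ w → h w ≡ h a ⊎ h w ≡ suc (h a)
    values w = ≤∧≤1+⇒≡∨≡1+ (minimal w) (≮⇒≥ λ 2+ha≤hw → <⇒≱ <4 (4≤EdgeSum∣-∣ {a} {w} 2+ha≤hw))
    hu≢hv : h u ≢ h v
    hu≢hv hu≡hv = contradiction (subst (0 <_) (m≡n⇒∣m-n∣≡0 hu≡hv) 0<∣hu-hv∣) λ ()

snoc : {A : Adjacency n} {a u v : Fin n} {k : ℕ} → Walk A a u k → A u v ≡ true → Walk A a v (suc k)
snoc here        uv = step uv here
snoc (step e wk) uv = step e (snoc wk uv)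

Walk-zero⇒≡ : {A : Adjacency n} {u v : Fin n} → Walk A u v 0 → u ≡ v
Walk-zero⇒≡ here = refl

m+n≡o+p⇒∣n-p∣≡∣o-m∣ : ∀ m n o p → m + n ≡ o + p → ∣ n - p ∣ ≡ ∣ o - m ∣
m+n≡o+p⇒∣n-p∣≡∣o-m∣ m n o p eq = begin
  ∣ n - p ∣          ≡⟨ ∣m+n-m+o∣≡∣n-o∣ m n p ⟨
  ∣ m + n - m + p ∣  ≡⟨ cong ∣_- m + p ∣ eq ⟩
  ∣ o + p - m + p ∣  ≡⟨ cong₂ ∣_-_∣ (+-comm o p) (+-comm m p) ⟩
  ∣ p + o - p + m ∣  ≡⟨ ∣m+n-m+o∣≡∣n-o∣ p o m ⟩
  ∣ o - m ∣          ∎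
  where open ≡-Reasoning

-- The indicator terms are exactly the contributions of w to n_u and n_v.
closer-balance : ∀ x y → x ≤ suc y → y ≤ suc x → x + indicator (x <ᵇ y) ≡ y + indicator (y <ᵇ x)
closer-balance x y x≤1+y y≤1+x with x <ᵇ y | <ᵇ-reflects-< x y | y <ᵇ x | <ᵇ-reflects-< y x
... | true  | ofʸ x<y  | true  | ofʸ y<x  = contradiction x<y (<-asym y<x)
... | true  | ofʸ x<y  | false | _        =
  trans (+-comm x 1) (trans (≤-antisym x<y y≤1+x) (sym (+-identityʳ y)))
... | false | _        | true  | ofʸ y<x  =
  trans (+-identityʳ x) (trans (≤-antisym x≤1+y y<x) (+-comm 1 y))
... | false | ofⁿ x≮y  | false | ofⁿ y≮x  = cong (_+ 0) (≤-antisym (≮⇒≥ y≮x) (≮⇒≥ x≮y))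

module _ (G : SimpleGraph n) (d : Fin n → Fin n → ℕ) (isDist : IsDistance G d) where

  d-step : ∀ w {u v} → adj G u v ≡ true → d w v ≤ suc (d w u)
  d-step w {u} {v} uv = proj₂ (isDist w v) _ (snoc (proj₁ (isDist w u)) uv)

  Tr-pos : ∀ {a b} → b ≢ a → 0 < Tr d a
  Tr-pos {a} {b} b≢a = <-≤-trans 0<d (term≤Σ-Fin n (λ w → d w a) b)
    where
    0<d : 0 < d b a
    0<d with d b a | proj₁ (isDist b a)
    ... | zero  | walk = contradiction (Walk-zero⇒≡ walk) b≢a
    ... | suc _ | _    = z<s

  Tr+closerTo : ∀ {u v} → adj G u v ≡ true → Tr d u + closerTo d u v ≡ Tr d v + closerTo d v u
  Tr+closerTo {u} {v} uv = begin
    Tr d u + closerTo d u v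
      ≡⟨ Σ-Fin-distrib-+ n (λ w → d w u) (λ w → indicator (d w u <ᵇ d w v)) ⟨
    Σ-Fin n (λ w → d w u + indicator (d w u <ᵇ d w v))
      ≡⟨ Σ-Fin-cong n (λ w → closer-balance (d w u) (d w v) (d-step w vu) (d-step w uv)) ⟩
    Σ-Fin n (λ w → d w v + indicator (d w v <ᵇ d w u))
      ≡⟨ Σ-Fin-distrib-+ n (λ w → d w v) (λ w → indicator (d w v <ᵇ d w u)) ⟩
    Tr d v + closerTo d v u ∎
    where
    open ≡-Reasoning
    vu = trans (SimpleGraph.sym G v u) uv

  Mostar≡EdgeSum∣Tr-Tr∣ : Mostar G d ≡ EdgeSum G (λ u v → ∣ Tr d u - Tr d v ∣)
  Mostar≡EdgeSum∣Tr-Tr∣ = EdgeSum-cong G λ {u} {v} uv →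
    trans (m+n≡o+p⇒∣n-p∣≡∣o-m∣ (Tr d u) (closerTo d u v) (Tr d v) (closerTo d v u) (Tr+closerTo uv))
          (∣-∣-comm (Tr d v) (Tr d u))

mainTheorem7 : ∀ (n : ℕ) (G : SimpleGraph n) (d : Fin n → Fin n → ℕ) →
    IsDistance G d → TwoEdgeConnected G → Mostar G d ≡ 3 →
    Σ ℕ (λ t → (0 < t) ×
      ((∀ v → (Tr d v ≡ t) ⊎ (Tr d v ≡ suc t)) ×
       (Σ (Fin n) (λ v → Tr d v ≡ t) × Σ (Fin n) (λ v → Tr d v ≡ suc t))))
mainTheorem7 n G d isDist tec Mo≡3 =
  let t , values , (a , Tra≡t) , (b , Trb≡1+t) =
        two-consecutive-values G tec (Tr d) (subst (0 <_) (sym E≡3) z<s) (≤-reflexive (cong suc E≡3))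
      b≢a : b ≢ a
      b≢a b≡a = 1+n≢n {t} (trans (sym Trb≡1+t) (trans (cong (Tr d) b≡a) Tra≡t))
  in t , subst (0 <_) Tra≡t (Tr-pos G d isDist b≢a) , values , (a , Tra≡t) , (b , Trb≡1+t)
  where
  E≡3 : EdgeSum G (λ u v → ∣ Tr d u - Tr d v ∣) ≡ 3
  E≡3 = trans (sym (Mostar≡EdgeSum∣Tr-Tr∣ G d isDist)) Mo≡3
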